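{- Let $\mathsf{Ag}=\{a,b\}$ with $a\neq b$. The schema of negative introspection is not valid: there exist a concurrent game structure $\mathcal{G}$, a state $Z$ and a formula $\phi\in\mathcal{L}$ such that $\mathcal{G},Z\nVdash\lnot\mathsf{K}_b\phi\to\mathsf{K}_b\lnot\mathsf{K}_b\phi$.
   Context: Fix a countable set $\mathsf{Prop}$ of atomic propositions and the finite set $\mathsf{Ag}$ of agents. A concurrent game structure is a tuple $\mathcal{G}=(\mathsf{Ac},\mathsf{V},\mathsf{E},\ell,(\sim_c)_{c\in\mathsf{Ag}})$ where $\mathsf{Ac}$ is a finite set of actions, $\mathsf{V}$ is a finite set of positions, $\mathsf{E}:\mathsf{V}\times\mathsf{Ac}^{\mathsf{Ag}}\to\mathsf{V}$ is a transition function, $\ell:\mathsf{V}\to\mathcal{P}(\mathsf{Prop})$ is a valuation, and for each agent $c$, $\sim_c\subseteq(\mathsf{V}\times\mathsf{V})\cup(\mathsf{Ac}\times\mathsf{Ac})$ is an equivalence relation. A joint action is a function $\alpha:\mathsf{Ag}\to\mathsf{Ac}$; $\alpha\sim_c\beta$ iff $\alpha(d)\sim_c\beta(d)$ for all $d$. A history is a sequence $\rho=v_0\alpha_1v_1\ldots\alpha_nv_n$ of positions and joint actions with $\mathsf{E}(v_i,\alpha_{i+1})=v_{i+1}$ for all $i<n$; $\rho_{\le i}=v_0\alpha_1\ldots\alpha_iv_i$, $\mathsf{last}(\rho)=v_n$; $\mathsf{Hist}$ is the set of histories. $\rho\sim_c\rho'$ for histories iff they have the same number $n$ of joint actions, their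 $i$-th positions are $\sim_c$-related for all $i\le n$ and their $i$-th joint actions are $\sim_c$-related for all $1\le i\le n$. A strategy is a function $\mathsf{Hist}\to\mathsf{Ac}$; an assignment is a function $\chi$ from $\mathsf{Ag}$ to strategies. $\rho$ is consistent with $\chi$ for $X\subseteq\mathsf{Ag}$ if $\alpha_{i+1}(d)=\chi(d)(\rho_{\le i})$ for all $i<n$, $d\in X$. The one-step continuation is $\mathsf{X}^\chi_{\mathcal G}\rho=v_0\alpha_1\ldots\alpha_nv_n\alpha_{n+1}v_{n+1}$ with $\alpha_{n+1}(d)=\chi(d)(\rho)$ for all $d$ and $v_{n+1}=\mathsf{E}(v_n,\alpha_{n+1})$. $\mathsf{Ag}^*$ is the set of finite words over $\mathsf{Ag}$ with no two equal adjacent letters; $\mathsf{Ag}^{\ge n}$ those of length $\ge n$; $cw$ denotes $w$ prefixed by $c$. An information perspective is a set $\mathrm{I}\subseteq\mathsf{Ag}^{\ge2}$; $\mathrm{I}_c=\{d: cd\in\mathrm{I}\}\cup\{c\}$; $\mathrm{I}[c]=\{w\in\mathsf{Ag}^{\ge2}: cw\in\mathrm{I}\}\cup\{w\in\mathrm{I}: w=cw'\text{ for some }w'\in\mathsf{Ag}^*\}$. $\chi\sim^{\mathrm{I}}_c\chi'$ iff $\chi(d)=\chi'(d)$ for all $d\in\mathrm{I}_c$. A state is a triple $(\chi,\mathrm{I},\rho)$ (assignment, information perspective, history); it is $c$-consistent if $\rho$ is consistent with $\chi$ for $\mathrm{I}_c$. $(\chi,\mathrm{I},\rho)\trianglelefteq_c(\chi',\mathrm{I}',\rho')$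 iff $\chi\sim^{\mathrm{I}}_c\chi'$, $\mathrm{I}[c]\subseteq\mathrm{I}'$, $\rho\sim_c\rho'$, and both states are $c$-consistent. Formulas of $\mathcal{L}$: $\phi::=p\mid\bot\mid\phi\to\phi\mid\mathsf{K}_c\phi\mid\mathsf{X}\phi$ with $p\in\mathsf{Prop}$, $c\in\mathsf{Ag}$ ($\lnot\phi$ is $\phi\to\bot$). Truth at $Z=(\chi,\mathrm{I},\rho)$: $\mathcal{G},Z\Vdash p$ iff $p\in\ell(\mathsf{last}(\rho))$; $\bot$ is never true; $\to$ is classical; $\mathcal{G},Z\Vdash\mathsf{K}_c\phi$ iff $\mathcal{G},Z'\Vdash\phi$ for all $Z'$ with $Z\trianglelefteq_cZ'$; $\mathcal{G},Z\Vdash\mathsf{X}\phi$ iff $\mathcal{G},(\chi,\mathrm{I},\mathsf{X}^\chi_{\mathcal G}\rho)\Vdash\phi$. A formula is valid if it is true at every state of every concurrent game structure. -}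

module Defs where

open import Data.Nat using (ℕ; _≤_)
open import Data.Fin using (Fin)
open import Data.List using (List; []; _∷_; length)
open import Data.Product using (_×_; Σ; ∃; _,_)
open import Data.Sum using (_⊎_; inj₁; inj₂)
open import Data.Unit using (⊤)
open import Data.Empty using (⊥)
open import Level using (0ℓ)
open import Relation.Binary.PropositionalEquality using (_≡_; _≢_)
open import Relation.Binary.Structures using (IsEquivalence)

data Ag : Set where
  a b : Ag

record CGS : Set₁ where
  field
    nAc : ℕ
    nV  : ℕ
  Ac : Set
  Ac = Fin nAc
  V : Set
  V = Fin nV
  JA : Set
  JA = Ag → Ac
  field
    E      : V → JA → V
    ℓ      : V → ℕ → Set
    _∼[_]_ : (V ⊎ Ac) → Ag → (V ⊎ Ac) → Set
    ∼-equiv : (c : Ag) → IsEquivalence (λ x y → x ∼[ c ] y)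

module Game (G : CGS) where
  open CGS G public

  _∼JA[_]_ : JA → Ag → JA → Set
  α ∼JA[ c ] β = (d : Ag) → inj₂ (α d) ∼[ c ] inj₂ (β d)

  -- histories v₀ α₁ v₁ … αₙ vₙ; since E is a function, v_{i+1} = E vᵢ αᵢ₊₁
  -- is determined, so a history is an initial position plus a list of
  -- joint actions (snoc-style).
  data Hist : Set where
    start : V → Hist
    snoc  : Hist → JA → Hist

  last : Hist → V
  last (start v)  = v
  last (snoc h α) = E (last h) α

  _∼H[_]_ : Hist → Ag → Hist → Set
  start v   ∼H[ c ] start v'    = inj₁ v ∼[ c ] inj₁ v'
  start _   ∼H[ c ] snoc _ _    = ⊥
  snoc _ _  ∼H[ c ] start _     = ⊥
  snoc h α  ∼H[ c ] snoc h' α'  =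
    (h ∼H[ c ] h') × (α ∼JA[ c ] α') × (inj₁ (E (last h) α) ∼[ c ] inj₁ (E (last h') α'))

  Strategy : Set
  Strategy = Hist → Ac

  Assignment : Set
  Assignment = Ag → Strategy

  Consistent : Assignment → (Ag → Set) → Hist → Set
  Consistent χ X (start _)  = ⊤
  Consistent χ X (snoc h α) = Consistent χ X h × ((d : Ag) → X d → α d ≡ χ d h)

  stepχ : Assignment → Hist → Hist
  stepχ χ ρ = snoc ρ (λ d → χ d ρ)

NoAdj : List Ag → Set
NoAdj []            = ⊤
NoAdj (x ∷ [])      = ⊤
NoAdj (x ∷ y ∷ w)   = (x ≢ y) × NoAdj (y ∷ w)

AgGe2 : List Ag → Set
AgGe2 w = NoAdj w × (2 ≤ length w)

record InfoPersp : Set₁ where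
  field
    mem    : List Ag → Set
    mem⊆   : (w : List Ag) → mem w → AgGe2 w
open InfoPersp public

Ic : InfoPersp → Ag → Ag → Set
Ic I c d = mem I (c ∷ d ∷ []) ⊎ d ≡ c

I[_] : InfoPersp → Ag → List Ag → Set
I[ I ] c w = (AgGe2 w × mem I (c ∷ w)) ⊎ (mem I w × ∃ λ w' → w ≡ c ∷ w')

data Form : Set where
  var  : ℕ → Form
  ⊥'   : Form
  _⇒_  : Form → Form → Form
  K    : Ag → Form → Form
  X    : Form → Form

¬' : Form → Form
¬' φ = φ ⇒ ⊥'

module Semantics (G : CGS) where
  open Game G public

  record State : Set₁ where
    constructor ⟨_,_,_⟩
    field
      χ : Assignment
      I : InfoPersp
      ρ : Hist
  open State public

  -- χ ∼^I_c χ' (equality of strategies taken pointwise)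
  _∼A[_,_]_ : Assignment → InfoPersp → Ag → Assignment → Set
  χ ∼A[ I , c ] χ' = (d : Ag) → Ic I c d → (h : Hist) → χ d h ≡ χ' d h

  cConsistent : Ag → State → Set
  cConsistent c Z = Consistent (χ Z) (Ic (I Z) c) (ρ Z)

  _⊴[_]_ : State → Ag → State → Set
  Z ⊴[ c ] Z' =
    (χ Z ∼A[ I Z , c ] χ Z')
    × ((w : List Ag) → I[ I Z ] c w → mem (I Z') w)
    × (ρ Z ∼H[ c ] ρ Z')
    × cConsistent c Z
    × cConsistent c Z'

  _⊩_ : State → Form → Set₁
  Z ⊩ var p   = Level.Lift _ (ℓ (last (ρ Z)) p)
  Z ⊩ ⊥'      = Level.Lift _ ⊥
  Z ⊩ (φ ⇒ ψ) = Z ⊩ φ → Z ⊩ ψ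
  Z ⊩ K c φ   = (Z' : State) → Z ⊴[ c ] Z' → Z' ⊩ φ
  Z ⊩ X φ     = ⟨ χ Z , I Z , stepχ (χ Z) (ρ Z) ⟩ ⊩ φ

{-# OPTIONS --safe #-}
-- Player b alone moves the token, to the position named by her action, and
-- p = var 0 holds at position 1.  At the initial state where b plays 1
-- and the perspective is empty, a does not know X p (for all a knows, b plays
-- 0), and b, who considers this very state possible, does not know K_a X p.
-- But b also considers possible the perspective {bab}, in which b knows that
-- a knows b's strategy; then b's strategy is fixed along every ⊴_b ⊴_a chain,
-- so K_b K_a X p holds there, and b does not know that she does not know
-- K_a X p.
module Submission where

open import Defs
open import Data.Empty using (⊥)
open import Data.Fin using (Fin; zero; suc)
open import Data.List using (List; []; _∷_)
open import Data.Nat using (s≤s; z≤n)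
open import Data.Product using (Σ; _,_)
open import Data.Sum using (inj₁; inj₂)
open import Data.Unit using (tt)
open import Level using (0ℓ; lift; lower)
open import Relation.Binary.Construct.Always as Always using (Always)
open import Relation.Binary.PropositionalEquality using (_≡_; refl; sym; trans)
open import Relation.Nullary using (¬_)

emptyPersp : InfoPersp
emptyPersp = record { mem = λ _ → ⊥ ; mem⊆ = λ _ () }

singletonPersp : (w : List Ag) → AgGe2 w → InfoPersp
singletonPersp w w∈Ag≥2 = record
  { mem = _≡ w ; mem⊆ = λ { _ refl → w∈Ag≥2 } }

I[emptyPersp]⊆ : ∀ I c w → I[ emptyPersp ] c w → mem I w
I[emptyPersp]⊆ I c w (inj₁ (_ , ()))
I[emptyPersp]⊆ I c w (inj₂ (() , _))

module Knowledge (G : CGS) where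
  open Semantics G

  ⊴-perspective-tail : ∀ {c d e} Z Z′ → Z ⊴[ c ] Z′ →
                       mem (I Z) (c ∷ d ∷ e ∷ []) → mem (I Z′) (d ∷ e ∷ [])
  ⊴-perspective-tail Z _ (_ , I[c]⊆I′ , _) cde∈I with mem⊆ (I Z) _ cde∈I
  ... | (_ , d≢e , _) , _ =
    I[c]⊆I′ _ (inj₁ (((d≢e , tt) , s≤s (s≤s z≤n)) , cde∈I))

  ⊴-⊴-own-strategy : ∀ {c d} Z Z′ Z″ → Z ⊴[ c ] Z′ → Z′ ⊴[ d ] Z″ →
                     mem (I Z) (c ∷ d ∷ c ∷ []) →
                     ∀ h → χ Z c h ≡ χ Z″ c h
  ⊴-⊴-own-strategy {c} Z Z′ _ Z⊴Z′@(χ∼χ′ , _) (χ′∼χ″ , _) cdc∈I h =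
    trans (χ∼χ′ c (inj₂ refl) h)
          (χ′∼χ″ c (inj₁ (⊴-perspective-tail Z Z′ Z⊴Z′ cdc∈I)) h)

  negative-introspection-fails : ∀ c φ Z Z′ →
    Z ⊴[ c ] Z′ → Z′ ⊩ K c φ → ¬ (Z ⊩ K c φ) →
    ¬ (Z ⊩ (¬' (K c φ) ⇒ K c (¬' (K c φ))))
  negative-introspection-fails c φ Z Z′ Z⊴Z′ Z′⊩Kφ Z⊮Kφ introspection =
    lower (introspection (λ Z⊩Kφ → lift (Z⊮Kφ Z⊩Kφ)) Z′ Z⊴Z′ Z′⊩Kφ)

goal : Fin 2
goal = suc zero

bSteers : CGS
bSteers = record
  { nAc = 2 ; nV = 2
  ; E = λ _ α → α b
  ; ℓ = λ v _ → v ≡ goal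
  ; _∼[_]_ = λ x _ → Always {ℓ = 0ℓ} x
  ; ∼-equiv = λ _ → Always.isEquivalence _ _
  }

open Semantics bSteers
open Knowledge bSteers

bPlays : Fin 2 → Assignment
bPlays _ a _ = zero
bPlays i b _ = i

initial : Hist
initial = start zero

emptyPersp-⊴ : ∀ {c χ χ′} I′ → χ ∼A[ emptyPersp , c ] χ′ →
               ⟨ χ , emptyPersp , initial ⟩ ⊴[ c ] ⟨ χ′ , I′ , initial ⟩
emptyPersp-⊴ I′ χ∼χ′ = χ∼χ′ , I[emptyPersp]⊆ I′ _ , _ , tt , tt

bab : List Ag
bab = b ∷ a ∷ b ∷ []

bab∈Ag≥2 : AgGe2 bab
bab∈Ag≥2 = ((λ ()) , (λ ()) , tt) , s≤s (s≤s z≤n)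

KaXp : Form
KaXp = K a (X (var 0))

lemma5 : Σ CGS λ G → Σ (Semantics.State G) λ Z → Σ Form λ φ →
    ¬ (Semantics._⊩_ G Z ((¬' (K b φ)) ⇒ K b (¬' (K b φ))))
lemma5 = bSteers , Z₀ , KaXp ,
         negative-introspection-fails b KaXp Z₀ Z₁ Z₀⊴Z₁ Z₁⊩KbKaXp Z₀⊮KbKaXp
  where
  Z₀ Z₁ : State
  Z₀ = ⟨ bPlays goal , emptyPersp , initial ⟩
  Z₁ = ⟨ bPlays goal , singletonPersp bab bab∈Ag≥2 , initial ⟩

  Z₀⊴Z₀ : Z₀ ⊴[ b ] Z₀
  Z₀⊴Z₀ = emptyPersp-⊴ emptyPersp (λ _ _ _ → refl)

  Z₀⊴Z₁ : Z₀ ⊴[ b ] Z₁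
  Z₀⊴Z₁ = emptyPersp-⊴ (I Z₁) (λ _ _ _ → refl)

  a-unaware-of-b : ∀ {i j} → bPlays i ∼A[ emptyPersp , a ] bPlays j
  a-unaware-of-b .a (inj₂ refl) _ = refl

  Z₀⊮KbKaXp : ¬ (Z₀ ⊩ K b KaXp)
  Z₀⊮KbKaXp Z₀⊩KbKaXp
    with lower (Z₀⊩KbKaXp Z₀ Z₀⊴Z₀ ⟨ bPlays zero , emptyPersp , initial ⟩
                  (emptyPersp-⊴ emptyPersp a-unaware-of-b))
  ... | ()

  Z₁⊩KbKaXp : Z₁ ⊩ K b KaXp
  Z₁⊩KbKaXp Z₂ Z₁⊴Z₂ Z₃ Z₂⊴Z₃ =
    lift (sym (⊴-⊴-own-strategy Z₁ Z₂ Z₃ Z₁⊴Z₂ Z₂⊴Z₃ refl (ρ Z₃)))
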